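{- Let $G=(V,E)$ be a graph with an ordering $E=\{e_1,\dots,e_m\}$ of its edges, and suppose $G$ has an $f$-MFD connectivity blocking set $\{(e_i,F_i)\}_{i=1}^m$. Then for every $S\subseteq V$, the induced subgraph $G[S]=(S,E_S)$, with the edge order induced from that of $G$, has $$\left\{\left(e_i,\ (F_i\cap V\cap S)\cup\left(F_i\cap E\cap \tbinom{S}{2}\right)\right)\right\}_{e_i\in E_S}$$ as an $f$-MFD connectivity blocking set.
   Context: For $F\subseteq V\cup E$, $G-F$ is the graph obtained by deleting the vertices in $F\cap V$ (with their incident edges) and the edges in $F\cap E$. For $v\in V$ let $\deg_G(v,F)=|\{u\in N_G(v): u\in F\text{ or }\{u,v\}\in F\}|$ and $\deg_G(F)=\max_{v\in V\setminus F}\deg_G(v,F)$. A set $F$ damages an edge $e$ if $e$ is not an edge of $G-F$ (i.e. $e\in F$ or an endpoint of $e$ lies in $F$). Write $e_i=\{u_i,v_i\}$ and $G_{<i}=(V,\{e_1,\dots,e_{i-1}\})$. Given $G$ with ordered edges $e_1,\dots,e_m$, a connectivity blocking set is a collection of pairs $\{(e_i,F_i)\}_{i=1}^m$ with $F_i\subseteq V\cup E$ such that (1) $F_i$ does not damage $e_i$, and (2) $u_i$ and $v_i$ are disconnected in $G_{<i}-F_i$. It is an $f$-MFD connectivity blocking set if moreover $\deg_G(F_i)\le f$ for all $i$. For a set $S$, $\binom{S}{2}$ denotes the set of unordered pairs of elements of $S$. -}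

module Defs where

open import Data.Bool using (Bool; true; false; _∧_; _∨_; not; T; if_then_else_)
open import Data.Nat using (ℕ; zero; suc; _⊔_; _≤_; _+_)
open import Data.Fin using (Fin; toℕ)
open import Data.Fin.Properties using (_≟_)
open import Data.List using (List; []; _∷_; map; filterᵇ; allFin; take; lookup; length; foldr)
open import Data.Bool.ListAction using (any)
open import Data.List.Relation.Unary.All using (All)
open import Data.List.Relation.Unary.AllPairs using (AllPairs)
open import Data.Product using (_×_; _,_; proj₁; proj₂)
open import Relation.Nullary using (¬_)
open import Relation.Nullary.Decidable using (⌊_⌋)
open import Relation.Binary.PropositionalEquality using (_≡_; _≢_)
open import Relation.Binary.Construct.Closure.ReflexiveTransitive using (Star)

VSet : ℕ → Set
VSet n = Fin n → Bool

-- A set of unordered pairs {a,b}: {a,b} is in X iff X a b or X b a.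
ESet : ℕ → Set
ESet n = Fin n → Fin n → Bool

memE : ∀ {n} → ESet n → Fin n → Fin n → Bool
memE X a b = X a b ∨ X b a

-- An edge {u,v} is stored as an ordered pair (u , v).
Edge : ℕ → Set
Edge n = Fin n × Fin n

sameᵇ : ∀ {n} → Edge n → Fin n → Fin n → Bool
sameᵇ (x , y) a b = (⌊ x ≟ a ⌋ ∧ ⌊ y ≟ b ⌋) ∨ (⌊ x ≟ b ⌋ ∧ ⌊ y ≟ a ⌋)

inListᵇ : ∀ {n} → List (Edge n) → Fin n → Fin n → Bool
inListᵇ L a b = any (λ e → sameᵇ e a b) L

record Graph (n : ℕ) : Set where
  constructor graph
  field
    V : VSet n
    E : List (Edge n)
open Graph public

IsSimple : ∀ {n} → Graph n → Set
IsSimple G =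
  All (λ e → T (V G (proj₁ e)) × T (V G (proj₂ e)) × proj₁ e ≢ proj₂ e) (E G)
  × AllPairs (λ e e′ → ¬ T (sameᵇ e (proj₁ e′) (proj₂ e′))) (E G)

isEdgeᵇ : ∀ {n} → Graph n → Fin n → Fin n → Bool
isEdgeᵇ G a b = inListᵇ (E G) a b

-- A set F ⊆ V ∪ E, split into its vertex part and its edge part.
record FSet (n : ℕ) : Set where
  constructor fset
  field
    FV : VSet n
    FE : ESet n
open FSet public

_⊆VE_ : ∀ {n} → FSet n → Graph n → Set
F ⊆VE G = (∀ a → T (FV F a) → T (V G a))
        × (∀ a b → T (FE F a b) → T (isEdgeᵇ G a b))

Damages : ∀ {n} → FSet n → Edge n → Set
Damages F (u , v) = T (memE (FE F) u v ∨ FV F u ∨ FV F v)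

countᵇ : ∀ {A : Set} → (A → Bool) → List A → ℕ
countᵇ p [] = 0
countᵇ p (x ∷ xs) = (if p x then 1 else 0) + countᵇ p xs

degV : ∀ {n} → Graph n → Fin n → FSet n → ℕ
degV {n} G v F =
  countᵇ (λ u → isEdgeᵇ G u v ∧ (FV F u ∨ memE (FE F) u v)) (allFin n)

-- deg_G(F) = max_{v ∈ V ∖ F} deg_G(v,F)   (max of the empty set taken as 0)
degF : ∀ {n} → Graph n → FSet n → ℕ
degF {n} G F =
  foldr _⊔_ 0 (map (λ v → degV G v F)
                   (filterᵇ (λ v → V G v ∧ not (FV F v)) (allFin n)))

Adj : ∀ {n} → VSet n → List (Edge n) → FSet n → Fin n → Fin n → Set
Adj Vs L F x y =
  T (inListᵇ L x y) × T (Vs x) × T (Vs y)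
  × ¬ T (FV F x) × ¬ T (FV F y) × ¬ T (memE (FE F) x y)

Connected : ∀ {n} → VSet n → List (Edge n) → FSet n → Fin n → Fin n → Set
Connected Vs L F = Star (Adj Vs L F)

BSet : ℕ → Set
BSet n = List (Edge n × FSet n)

IsMFDCBS : ∀ {n} → ℕ → Graph n → BSet n → Set
IsMFDCBS f G B =
  map proj₁ B ≡ E G
  × (∀ (i : Fin (length B)) →
       let e = proj₁ (lookup B i)
           F = proj₂ (lookup B i)
           G<i = take (toℕ i) (E G)
       in F ⊆VE G
          × ¬ Damages F e
          × ¬ Connected (V G) G<i F (proj₁ e) (proj₂ e)
          × degF G F ≤ f)

inS : ∀ {n} → VSet n → Edge n → Bool
inS S (a , b) = S a ∧ S b

induced : ∀ {n} → Graph n → VSet n → Graph n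
induced G S = graph (λ v → V G v ∧ S v) (filterᵇ (inS S) (E G))

restrictF : ∀ {n} → Graph n → VSet n → FSet n → FSet n
restrictF G S F = fset (λ v → FV F v ∧ V G v ∧ S v)
                       (λ a b → FE F a b ∧ isEdgeᵇ G a b ∧ S a ∧ S b)

restrictB : ∀ {n} → Graph n → VSet n → BSet n → BSet n
restrictB G S B =
  map (λ p → proj₁ p , restrictF G S (proj₂ p))
      (filterᵇ (λ p → inS S (proj₁ p)) B)

-- Passing from G to G[S] and from F_i to its restriction F_i′ only removes vertices
-- and edges, and an edge of G[S] deleted by F_i is also deleted by F_i′, since it lies
-- in E ∩ (S choose 2).  So a path from u_i to v_i in G[S]_{<i} − F_i′ would be a path
-- in G_{<i} − F_i; F_i′ damages no more than F_i; and a vertex of G[S] outside F_i′ is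
-- outside F_i, with deg_{G[S]}(v, F_i′) ≤ deg_G(v, F_i).  What remains is bookkeeping:
-- the edges preceding e_i in G[S] are those preceding it in G, filtered by S.
module Submission where

open import Defs
open import Level using (Level)
open import Function using (_∘_)
open import Function.Bundles using (Equivalence)
open import Data.Bool using (Bool; true; false; T; _∧_; _∨_; not)
open import Data.Bool.Properties using (T-∧; T-∨; ∨-comm)
open import Data.Empty using (⊥-elim)
open import Data.Unit using (tt)
open import Data.Nat using (ℕ; _⊔_; _≤_; z≤n; s≤s)
open import Data.Nat.Properties using (≤-trans; m≤n⇒m≤1+n; ⊔-mono-≤; m≤n⇒m≤o⊔n)
open import Data.Fin using (Fin; toℕ; zero; suc)
open import Data.Fin.Properties using (_≟_)
open import Data.Product using (_×_; _,_; proj₁; proj₂)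
import Data.Product as Product
import Data.Sum as Sum
open import Data.Sum using (_⊎_; inj₁; inj₂)
open import Data.List using (List; []; _∷_; map; filterᵇ; allFin; take; lookup; length; foldr)
open import Data.List.Properties using (map-∘; filter-accept; filter-reject)
open import Data.List.Relation.Unary.Any.Properties using (any⁺; any⁻; filter⁺; lookup-result)
open import Data.List.Relation.Binary.Sublist.Propositional as Sublist using (_⊆_)
open import Data.List.Relation.Binary.Sublist.Propositional.Properties using (take-⊆; filter-⊆)
open import Relation.Nullary using (¬_)
open import Relation.Nullary.Decidable using (T?; toWitness; ⌊_⌋)
open import Relation.Binary.PropositionalEquality using (_≡_; refl; sym; trans; cong; cong₂; subst)
import Relation.Binary.Construct.Closure.ReflexiveTransitive as Star

open Equivalence using (to; from)

private
  variable
    a b ℓ : Level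
    A : Set a
    B : Set b

T-∧-map : ∀ {x y z w} → (T x → T z) → (T y → T w) → T (x ∧ y) → T (z ∧ w)
T-∧-map f g = from T-∧ ∘ Product.map f g ∘ to T-∧

T-∨-map : ∀ {x y z w} → (T x → T z) → (T y → T w) → T (x ∨ y) → T (z ∨ w)
T-∨-map f g = from T-∨ ∘ Sum.map f g ∘ to T-∨

T-not-contrapose : ∀ {x y} → (T x → T y) → T (not y) → T (not x)
T-not-contrapose {false}          _   _ = tt
T-not-contrapose {true}  {true}   _   ()
T-not-contrapose {true}  {false}  x⇒y _ = x⇒y tt

countᵇ-mono : {p q : A → Bool} → (∀ x → T (p x) → T (q x)) →
              ∀ xs → countᵇ p xs ≤ countᵇ q xs
countᵇ-mono p⇒q [] = z≤n
countᵇ-mono {p = p} {q} p⇒q (x ∷ xs) with p x | q x | p⇒q x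
... | true  | true  | _   = s≤s (countᵇ-mono p⇒q xs)
... | true  | false | px⇒qx = ⊥-elim (px⇒qx tt)
... | false | true  | _   = m≤n⇒m≤1+n (countᵇ-mono p⇒q xs)
... | false | false | _   = countᵇ-mono p⇒q xs

foldr-⊔-filterᵇ-mono : {p q : A → Bool} {g h : A → ℕ} →
  (∀ x → T (p x) → T (q x)) → (∀ x → T (p x) → g x ≤ h x) → ∀ xs →
  foldr _⊔_ 0 (map g (filterᵇ p xs)) ≤ foldr _⊔_ 0 (map h (filterᵇ q xs))
foldr-⊔-filterᵇ-mono p⇒q g≤h [] = z≤n
foldr-⊔-filterᵇ-mono {p = p} {q} {g} {h} p⇒q g≤h (x ∷ xs) with p x | q x | p⇒q x | g≤h x
... | true  | true  | _      | gx≤hx = ⊔-mono-≤ (gx≤hx tt) (foldr-⊔-filterᵇ-mono p⇒q g≤h xs)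
... | true  | false | px⇒qx | _     = ⊥-elim (px⇒qx tt)
... | false | true  | _      | _     = m≤n⇒m≤o⊔n (h x) (foldr-⊔-filterᵇ-mono p⇒q g≤h xs)
... | false | false | _      | _     = foldr-⊔-filterᵇ-mono p⇒q g≤h xs

map-filterᵇ : (h : A → B) (f : B → Bool) (xs : List A) →
              map h (filterᵇ (f ∘ h) xs) ≡ filterᵇ f (map h xs)
map-filterᵇ h f [] = refl
map-filterᵇ h f (x ∷ xs) with f (h x)
... | true  = cong (h x ∷_) (map-filterᵇ h f xs)
... | false = map-filterᵇ h f xs

Prefixwise : (A → B) → (List B → A → Set ℓ) → List A → Set ℓ
Prefixwise h P xs = ∀ (i : Fin (length xs)) → P (take (toℕ i) (map h xs)) (lookup xs i)

module _ {h : A → B} where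

  prefixwise-∷ : ∀ {P : List B → A → Set ℓ} {x xs} →
    P [] x → Prefixwise h (P ∘ (h x ∷_)) xs → Prefixwise h P (x ∷ xs)
  prefixwise-∷ px pxs zero    = px
  prefixwise-∷ px pxs (suc i) = pxs i

  prefixwise-filterᵇ⁺ : ∀ (f : B → Bool) {P : List B → A → Set ℓ} {xs} →
    Prefixwise h (λ pre x → T (f (h x)) → P (filterᵇ f pre) x) xs →
    Prefixwise h P (filterᵇ (f ∘ h) xs)
  prefixwise-filterᵇ⁺ f {xs = []} _ ()
  prefixwise-filterᵇ⁺ f {P} {x ∷ xs} pxs with f (h x) in fx
  ... | true  = prefixwise-∷ {P = P} (pxs zero x∈f) (prefixwise-filterᵇ⁺ f {P ∘ (h x ∷_)} {xs}
                  λ i → subst (λ pre → P pre _) (filter-accept (T? ∘ f) x∈f) ∘ pxs (suc i))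
    where
      x∈f : T (f (h x))
      x∈f = subst T (sym fx) tt
  ... | false = prefixwise-filterᵇ⁺ f {P} {xs}
                  λ i → subst (λ pre → P pre _) (filter-reject (T? ∘ f) x∉f) ∘ pxs (suc i)
    where
      x∉f : ¬ T (f (h x))
      x∉f = subst T fx

prefixwise-map⁺ : ∀ {C : Set a} {h : B → C} (g : A → B) {P : List C → B → Set ℓ} {xs} →
  Prefixwise (h ∘ g) (λ pre → P pre ∘ g) xs → Prefixwise h P (map g xs)
prefixwise-map⁺ g {xs = []} _ ()
prefixwise-map⁺ g {P} {x ∷ xs} pxs =
  prefixwise-∷ {P = P} (pxs zero) (prefixwise-map⁺ g {P ∘ (_ ∷_)} {xs} (pxs ∘ suc))

module _ {n : ℕ} where

  sameᵇ-sym : ∀ (e : Edge n) x y → sameᵇ e x y ≡ sameᵇ e y x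
  sameᵇ-sym (u , v) x y = ∨-comm (⌊ u ≟ x ⌋ ∧ ⌊ v ≟ y ⌋) (⌊ u ≟ y ⌋ ∧ ⌊ v ≟ x ⌋)

  sameᵇ-sound : ∀ (e : Edge n) {x y} → T (sameᵇ e x y) → e ≡ (x , y) ⊎ e ≡ (y , x)
  sameᵇ-sound (u , v) {x} {y} = Sum.map pair pair ∘ to (T-∨ {⌊ u ≟ x ⌋ ∧ ⌊ v ≟ y ⌋})
    where
      pair : ∀ {c d} → T (⌊ u ≟ c ⌋ ∧ ⌊ v ≟ d ⌋) → (u , v) ≡ (c , d)
      pair {c} {d} uv≡cd = let u≡c , v≡d = to (T-∧ {⌊ u ≟ c ⌋}) uv≡cd
                           in cong₂ _,_ (toWitness {a? = u ≟ c} u≡c) (toWitness {a? = v ≟ d} v≡d)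

  inListᵇ-sym : ∀ (L : List (Edge n)) x y → inListᵇ L x y ≡ inListᵇ L y x
  inListᵇ-sym []      x y = refl
  inListᵇ-sym (e ∷ L) x y = cong₂ _∨_ (sameᵇ-sym e x y) (inListᵇ-sym L x y)

  inListᵇ-⊆ : ∀ {L L′ : List (Edge n)} {x y} → L ⊆ L′ → T (inListᵇ L x y) → T (inListᵇ L′ x y)
  inListᵇ-⊆ {L} {L′} L⊆L′ = any⁺ _ ∘ Sublist.lookup L⊆L′ ∘ any⁻ _ L

  inListᵇ-filterᵇ : ∀ (S : VSet n) (L : List (Edge n)) {x y} →
    T (inListᵇ L x y) → T (S x) → T (S y) → T (inListᵇ (filterᵇ (inS S) L) x y)
  inListᵇ-filterᵇ S L {x} {y} xy∈L x∈S y∈S with filter⁺ (T? ∘ inS S) (any⁻ _ L xy∈L)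
  ... | inj₁ xy∈L′ = any⁺ _ xy∈L′
  ... | inj₂ xy∉S² = ⊥-elim (xy∉S² (edge-inS (sameᵇ-sound _ (lookup-result (any⁻ _ L xy∈L)))))
    where
      edge-inS : ∀ {e} → e ≡ (x , y) ⊎ e ≡ (y , x) → T (inS S e)
      edge-inS (inj₁ refl) = from T-∧ (x∈S , y∈S)
      edge-inS (inj₂ refl) = from T-∧ (y∈S , x∈S)

module Restriction {n : ℕ} (G : Graph n) (S : VSet n) (F : FSet n) where

  G′ : Graph n
  G′ = induced G S

  F′ : FSet n
  F′ = restrictF G S F

  FV-restrictF⁻ : ∀ {x} → T (FV F′ x) → T (FV F x)
  FV-restrictF⁻ = proj₁ ∘ to T-∧

  FV-restrictF⁺ : ∀ {x} → T (V G′ x) → T (FV F x) → T (FV F′ x)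
  FV-restrictF⁺ x∈V′ x∈F = from T-∧ (x∈F , x∈V′)

  FE-restrictF⁻ : ∀ {x y} → T (FE F′ x y) → T (FE F x y)
  FE-restrictF⁻ = proj₁ ∘ to T-∧

  memE-restrictF⁻ : ∀ {x y} → T (memE (FE F′) x y) → T (memE (FE F) x y)
  memE-restrictF⁻ = T-∨-map FE-restrictF⁻ FE-restrictF⁻

  memE-restrictF⁺ : ∀ {x y} → T (isEdgeᵇ G x y) → T (S x) → T (S y) →
                    T (memE (FE F) x y) → T (memE (FE F′) x y)
  memE-restrictF⁺ {x} {y} xy∈E x∈S y∈S = T-∨-map {FE F x y} {FE F y x}
    (λ xy∈F → from T-∧ (xy∈F , from T-∧ (xy∈E , from T-∧ (x∈S , y∈S))))
    (λ yx∈F → from T-∧ (yx∈F , from T-∧ (yx∈E , from T-∧ (y∈S , x∈S))))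
    where
      yx∈E : T (isEdgeᵇ G y x)
      yx∈E = subst T (inListᵇ-sym (E G) x y) xy∈E

  restrictF-⊆VE : F′ ⊆VE G′
  restrictF-⊆VE = (λ x → proj₂ ∘ to (T-∧ {FV F x})) , λ x y xy∈F′ →
    let _ , xy∈E∩S² = to (T-∧ {FE F x y}) xy∈F′
        xy∈E , xy∈S² = to (T-∧ {isEdgeᵇ G x y}) xy∈E∩S²
        x∈S , y∈S = to (T-∧ {S x}) xy∈S²
    in inListᵇ-filterᵇ S (E G) xy∈E x∈S y∈S

  damages-restrictF : ∀ e → Damages F′ e → Damages F e
  damages-restrictF (u , v) = T-∨-map memE-restrictF⁻ (T-∨-map FV-restrictF⁻ FV-restrictF⁻)

  adj-restrictF : ∀ {L} → L ⊆ E G → ∀ {x y} →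
    Adj (V G′) (filterᵇ (inS S) L) F′ x y → Adj (V G) L F x y
  adj-restrictF {L} L⊆E (xy∈L′ , x∈V′ , y∈V′ , x∉F′ , y∉F′ , xy∉F′) =
    xy∈L , proj₁ (to T-∧ x∈V′) , proj₁ (to T-∧ y∈V′) ,
    x∉F′ ∘ FV-restrictF⁺ x∈V′ , y∉F′ ∘ FV-restrictF⁺ y∈V′ ,
    xy∉F′ ∘ memE-restrictF⁺ (inListᵇ-⊆ L⊆E xy∈L) (proj₂ (to T-∧ x∈V′)) (proj₂ (to T-∧ y∈V′))
    where
      xy∈L = inListᵇ-⊆ (filter-⊆ (T? ∘ inS S) L) xy∈L′

  connected-restrictF : ∀ {L} → L ⊆ E G → ∀ {x y} →
    Connected (V G′) (filterᵇ (inS S) L) F′ x y → Connected (V G) L F x y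
  connected-restrictF L⊆E = Star.map (adj-restrictF L⊆E)

  degV-restrictF : ∀ v → degV G′ v F′ ≤ degV G v F
  degV-restrictF v = countᵇ-mono
    (λ u → T-∧-map (inListᵇ-⊆ (filter-⊆ (T? ∘ inS S) (E G))) (T-∨-map FV-restrictF⁻ memE-restrictF⁻))
    (allFin n)

  degF-restrictF : degF G′ F′ ≤ degF G F
  degF-restrictF = foldr-⊔-filterᵇ-mono
    (λ v v∈V′∖F′ → let v∈V′ , v∉F′ = to T-∧ v∈V′∖F′
                   in from T-∧ (proj₁ (to T-∧ v∈V′) , T-not-contrapose (FV-restrictF⁺ v∈V′) v∉F′))
    (λ v _ → degV-restrictF v)
    (allFin n)

BlockingPair : ∀ {n} → ℕ → Graph n → List (Edge n) → Edge n × FSet n → Set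
BlockingPair f G L (e , F) =
  F ⊆VE G × ¬ Damages F e × ¬ Connected (V G) L F (proj₁ e) (proj₂ e) × degF G F ≤ f

restrictPair : ∀ {n} → Graph n → VSet n → Edge n × FSet n → Edge n × FSet n
restrictPair G S (e , F) = e , restrictF G S F

blockingPair-restrict : ∀ {n f} {G : Graph n} {S L} → L ⊆ E G → ∀ p →
  BlockingPair f G L p → BlockingPair f (induced G S) (filterᵇ (inS S) L) (restrictPair G S p)
blockingPair-restrict {G = G} {S} L⊆E (e , F) (_ , e-undamaged , e-cut , degF≤f) =
  restrictF-⊆VE , e-undamaged ∘ damages-restrictF e , e-cut ∘ connected-restrictF L⊆E ,
  ≤-trans degF-restrictF degF≤f
  where open Restriction G S F

mainTheorem3 : ∀ {n} (f : ℕ) (G : Graph n) (B : BSet n) (S : VSet n) →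
    IsSimple G →
    (∀ v → T (S v) → T (V G v)) →
    IsMFDCBS f G B →
    IsMFDCBS f (induced G S) (restrictB G S B)
mainTheorem3 f G@(graph _ .(map proj₁ B)) B S _ _ (refl , blocking) =
  edges , subst (λ L → ∀ i → BlockingPair f G′ (take (toℕ i) L) (lookup B′ i)) edges blocking′
  where
    G′ = induced G S
    B′ = restrictB G S B

    edges : map proj₁ B′ ≡ filterᵇ (inS S) (map proj₁ B)
    edges = trans (sym (map-∘ (filterᵇ (inS S ∘ proj₁) B))) (map-filterᵇ proj₁ (inS S) B)

    blocking′ : Prefixwise proj₁ (BlockingPair f G′) B′
    blocking′ = prefixwise-map⁺ (restrictPair G S) {BlockingPair f G′} {filterᵇ (inS S ∘ proj₁) B}
      (prefixwise-filterᵇ⁺ (inS S) {λ L → BlockingPair f G′ L ∘ restrictPair G S} {B} λ i _ →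
        blockingPair-restrict (take-⊆ (toℕ i) (map proj₁ B)) (lookup B i) (blocking i))
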